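{- For all integers $m\ge 0$ and $l\ge 1$, $$\left(\frac{[l][l+1]}{q^l}\right)^{m+1}-\left(\frac{[l-1][l]}{q^{l-1}}\right)^{m+1}=[2]\sum_{k=0}^{\lfloor m/2\rfloor}h_{m-2k}(\{1,q\}^{k+1})\frac{[2l]}{[2]}[l]^{2(m-k)}q^{ -l(m-k+1)}.$$
   Context: $q$ is an indeterminate and $[k]=\frac{1-q^k}{1-q}$. For integers $j\ge 0$ and $r\ge 1$, $h_j(\{1,q\}^r)$ denotes the complete homogeneous symmetric polynomial of degree $j$ in $2r$ variables, $r$ of which are specialised to $q$ and the other $r$ to $1$. -}

module Defs where

open import Level using (Level)
open import Algebra.Bundles using (CommutativeRing)
open import Data.Nat using (ℕ; zero; suc; _∸_)
open import Data.List using (List; []; _∷_; _++_; replicate)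

module QOps {c ℓ : Level} (R : CommutativeRing c ℓ) where
  open CommutativeRing R

  infixr 8 _^_
  _^_ : Carrier → ℕ → Carrier
  x ^ zero  = 1#
  x ^ suc n = x * (x ^ n)

  Σ< : ℕ → (ℕ → Carrier) → Carrier
  Σ< zero    f = 0#
  Σ< (suc n) f = Σ< n f + f n

  Σ≤ : ℕ → (ℕ → Carrier) → Carrier
  Σ≤ n f = Σ< (suc n) f

  -- q-integer [k] = (1 - q^k)/(1 - q) = 1 + q + ... + q^(k-1)
  qint : Carrier → ℕ → Carrier
  qint q k = Σ< k (λ i → q ^ i)

  -- [2l]/[2] = (1 - q^(2l))/(1 - q^2) = 1 + q^2 + ... + q^(2(l-1))  (exact polynomial quotient)
  qint2l/qint2 : Carrier → ℕ → Carrier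
  qint2l/qint2 q l = Σ< l (λ i → q ^ (2 Data.Nat.* i))

  -- complete homogeneous symmetric polynomial h_j in the variables of a list
  h : ℕ → List Carrier → Carrier
  h zero    _        = 1#
  h (suc j) []       = 0#
  h j       (x ∷ xs) = Σ≤ j (λ i → (x ^ i) * h (j ∸ i) xs)

  -- the multiset {1,q}^r : r copies of 1 and r copies of q
  ones-qs : Carrier → ℕ → List Carrier
  ones-qs q r = replicate r 1# ++ replicate r q

-- Write x = [l], C = q^l, P = [l] q^(-l), a = [l+1] and b = q[l-1]. The two bases on the
-- left are P a and P b, and a = b + (1 + C), so by a^(m+1) - b^(m+1) = (a - b) h_m(a,b) and the
-- homogeneity of h_m the left side is P^(m+1) (1 + C) h_m(a,b); on the right [2]·[2l]/[2] = x(1 + C).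
-- What remains is
--   h_m(a,b) = Σ_k C^k h_(m-2k)({x, xq}^(k+1)),
-- an instance of a general fact: if a + b = x + y and ab + c = xy, then
-- (1 - at)(1 - bt) = E - ct² with E = (1 - xt)(1 - yt), and expanding 1/(E - ct²) = Σ_k c^k t^(2k)/E^(k+1)
-- gives h_m(a,b) = Σ_k c^k h_(m-2k)({x,y}^(k+1)). Homogeneity then turns {x, xq} into x·{1, q}.

module Submission where

open import Defs
open import Level using (_⊔_)
open import Algebra.Bundles using (CommutativeRing)
open import Data.Nat using (ℕ; zero; suc; _∸_; _≤_; _<_; _≥_; s≤s; ⌊_/2⌋)
import Data.Nat as N
import Data.Nat.Properties as NP
open import Data.Nat.GeneralisedArithmetic using (fold)
open import Data.List using (List; []; _∷_; _++_; replicate)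
open import Data.List.Properties using (++-identityʳ)
open import Data.List.Relation.Binary.Pointwise using (Pointwise; []; _∷_; ++⁺; replicate⁺)
open import Data.Product using (_×_; _,_; proj₁; ∃)
open import Function using (id; _∘_)
open import Relation.Binary.PropositionalEquality as ≡ using (_≡_)
import Relation.Binary.Reasoning.Setoid as SetoidReasoning

module GeneratingFunctions {r ℓ} (R : CommutativeRing r ℓ) where
  open CommutativeRing R hiding (zero)
  open QOps R
  open import Algebra.Properties.Group +-group using (x≈z//y; ∙-cancelʳ)
  open import Algebra.Solver.Ring.NaturalCoefficients.Default commutativeSemiring
    using (solve; _:=_; _:+_; _:*_; con)
  open SetoidReasoning setoid

  ^-congˡ : ∀ {x y} n → x ≈ y → x ^ n ≈ y ^ n
  ^-congˡ zero    _   = refl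
  ^-congˡ (suc n) x≈y = *-cong x≈y (^-congˡ n x≈y)

  ^-homo-* : ∀ x m n → x ^ (m N.+ n) ≈ x ^ m * x ^ n
  ^-homo-* x zero    n = sym (*-identityˡ _)
  ^-homo-* x (suc m) n = trans (*-congˡ (^-homo-* x m n)) (sym (*-assoc _ _ _))

  ^-distrib-* : ∀ x y n → (x * y) ^ n ≈ x ^ n * y ^ n
  ^-distrib-* x y zero    = sym (*-identityˡ _)
  ^-distrib-* x y (suc n) = trans (*-congˡ (^-distrib-* x y n))
    (solve 4 (λ x y u v → x :* y :* (u :* v) := x :* u :* (y :* v)) refl x y (x ^ n) (y ^ n))

  1^n : ∀ n → 1# ^ n ≈ 1#
  1^n zero    = refl
  1^n (suc n) = trans (*-identityˡ _) (1^n n)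

  ^-assocʳ : ∀ x m n → x ^ (m N.* n) ≈ (x ^ m) ^ n
  ^-assocʳ x zero    n = sym (1^n n)
  ^-assocʳ x (suc m) n = begin
    x ^ (n N.+ m N.* n)    ≈⟨ ^-homo-* x n (m N.* n) ⟩
    x ^ n * x ^ (m N.* n)  ≈⟨ *-congˡ (^-assocʳ x m n) ⟩
    x ^ n * (x ^ m) ^ n    ≈⟨ ^-distrib-* x (x ^ m) n ⟨
    (x * x ^ m) ^ n        ∎

  ^-double : ∀ x n → x ^ (2 N.* n) ≈ x ^ n * x ^ n
  ^-double x n = trans (^-homo-* x n (n N.+ 0)) (*-congˡ (reflexive (≡.cong (x ^_) (NP.+-identityʳ n))))

  ^-inverse : ∀ {x y} → x * y ≈ 1# → ∀ n → x ^ n * y ^ n ≈ 1#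
  ^-inverse {x} {y} xy≈1 n = trans (sym (^-distrib-* x y n)) (trans (^-congˡ n xy≈1) (1^n n))

  power-split : ∀ {x y z} → z * y ≈ 1# → ∀ k j →
    (x * y) ^ suc (k N.+ (k N.+ j)) * (z ^ k * x ^ j) ≈ x * x ^ (2 N.* (k N.+ j)) * y ^ suc (k N.+ j)
  power-split {x} {y} {z} zy≈1 k j = begin
    (x * y) ^ suc (k N.+ u) * (z ^ k * x ^ j)
      ≈⟨ *-congʳ (^-distrib-* x y (suc (k N.+ u))) ⟩
    (x * x ^ (k N.+ u)) * (y * y ^ (k N.+ u)) * (z ^ k * x ^ j)
      ≈⟨ *-congʳ (*-cong (*-congˡ (^-homo-* x k u)) (*-congˡ (^-homo-* y k u))) ⟩
    (x * (x ^ k * x ^ u)) * (y * (y ^ k * y ^ u)) * (z ^ k * x ^ j)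
      ≈⟨ solve 8 (λ x xᵏ xᵘ y yᵏ yᵘ zᵏ xʲ →
                    (x :* (xᵏ :* xᵘ)) :* (y :* (yᵏ :* yᵘ)) :* (zᵏ :* xʲ)
                 := x :* (xᵘ :* (xᵏ :* xʲ)) :* (y :* yᵘ) :* (zᵏ :* yᵏ))
               refl x (x ^ k) (x ^ u) y (y ^ k) (y ^ u) (z ^ k) (x ^ j) ⟩
    x * (x ^ u * (x ^ k * x ^ j)) * (y * y ^ u) * (z ^ k * y ^ k)
      ≈⟨ *-cong (*-congʳ (*-congˡ (*-congˡ (sym (^-homo-* x k j))))) (^-inverse zy≈1 k) ⟩
    x * (x ^ u * x ^ u) * y ^ suc u * 1#
      ≈⟨ *-identityʳ _ ⟩
    x * (x ^ u * x ^ u) * y ^ suc u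
      ≈⟨ *-congʳ (*-congˡ (^-double x u)) ⟨
    x * x ^ (2 N.* u) * y ^ suc u ∎
    where u = k N.+ j

  Σ<-cong : ∀ n {f g} → (∀ k → k < n → f k ≈ g k) → Σ< n f ≈ Σ< n g
  Σ<-cong zero    f≈g = refl
  Σ<-cong (suc n) f≈g =
    +-cong (Σ<-cong n (λ k k<n → f≈g k (NP.m<n⇒m<1+n k<n))) (f≈g n (NP.n<1+n n))

  Σ<-suc : ∀ n f → Σ< (suc n) f ≈ f 0 + Σ< n (f ∘ suc)
  Σ<-suc zero    f = trans (+-identityˡ _) (sym (+-identityʳ _))
  Σ<-suc (suc n) f = trans (+-congʳ (Σ<-suc n f)) (+-assoc _ _ _)

  *-distribˡ-Σ< : ∀ n x f → x * Σ< n f ≈ Σ< n (λ k → x * f k)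
  *-distribˡ-Σ< zero    x f = zeroʳ x
  *-distribˡ-Σ< (suc n) x f = trans (distribˡ x _ _) (+-congʳ (*-distribˡ-Σ< n x f))

  -- A sequence s stands for the formal power series Σ s j t^j; the operations below are named
  -- after the corresponding operations on series, and x ⋆ s is the series s(x t).
  Seq : Set r
  Seq = ℕ → Carrier

  infix 4 _≋_
  _≋_ : Seq → Seq → Set ℓ
  s ≋ s′ = ∀ j → s j ≈ s′ j

  ≋-refl : ∀ {s} → s ≋ s
  ≋-refl _ = refl

  ≋-sym : ∀ {s s′} → s ≋ s′ → s′ ≋ s
  ≋-sym s≋s′ j = sym (s≋s′ j)

  ≋-trans : ∀ {s s′ s″} → s ≋ s′ → s′ ≋ s″ → s ≋ s″
  ≋-trans s≋s′ s′≋s″ j = trans (s≋s′ j) (s′≋s″ j)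

  δ : Seq
  δ zero    = 1#
  δ (suc _) = 0#

  infixl 6 _⊕_
  _⊕_ : Seq → Seq → Seq
  (s ⊕ s′) j = s j + s′ j

  infixr 7 _·_
  _·_ : Carrier → Seq → Seq
  (x · s) j = x * s j

  infixr 8 t·_
  t·_ : Seq → Seq
  (t· s) zero    = 0#
  (t· s) (suc j) = s j

  infixr 7 _⋆_
  _⋆_ : Carrier → Seq → Seq
  (x ⋆ s) j = x ^ j * s j

  infixl 9 _/[1-_t]
  _/[1-_t] : Seq → Carrier → Seq
  (s /[1- z t]) zero    = s zero
  (s /[1- z t]) (suc j) = s (suc j) + z * (s /[1- z t]) j

  infixl 9 _/[1-_t]^_
  _/[1-_t]^_ : Seq → Carrier → ℕ → Seq
  s /[1- z t]^ n = fold s _/[1- z t] n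

  t·-cong : ∀ {s s′} → s ≋ s′ → t· s ≋ t· s′
  t·-cong s≋s′ zero    = refl
  t·-cong s≋s′ (suc j) = s≋s′ j

  ⋆-congˡ : ∀ x {s s′} → s ≋ s′ → x ⋆ s ≋ x ⋆ s′
  ⋆-congˡ x s≋s′ j = *-congˡ (s≋s′ j)

  record IsLinear (F : Seq → Seq) : Set (r ⊔ ℓ) where
    field
      cong    : ∀ {s s′} → s ≋ s′ → F s ≋ F s′
      ⊕-homo  : ∀ s s′ → F (s ⊕ s′) ≋ F s ⊕ F s′
      ·-homo  : ∀ x s → F (x · s) ≋ x · F s
      t·-homo : ∀ s → F (t· s) ≋ t· F s

  id-linear : IsLinear id
  id-linear = record
    { cong = id ; ⊕-homo = λ _ _ → ≋-refl ; ·-homo = λ _ _ → ≋-refl ; t·-homo = λ _ → ≋-refl }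

  ∘-linear : ∀ {F G} → IsLinear F → IsLinear G → IsLinear (F ∘ G)
  ∘-linear {F} {G} F-lin G-lin = record
    { cong    = F.cong ∘ G.cong
    ; ⊕-homo  = λ s s′ → ≋-trans (F.cong (G.⊕-homo s s′)) (F.⊕-homo _ _)
    ; ·-homo  = λ x s → ≋-trans (F.cong (G.·-homo x s)) (F.·-homo x _)
    ; t·-homo = λ s → ≋-trans (F.cong (G.t·-homo s)) (F.t·-homo _)
    }
    where
    module F = IsLinear F-lin
    module G = IsLinear G-lin

  fold-linear : ∀ {F} → IsLinear F → ∀ n → IsLinear (λ s → fold s F n)
  fold-linear F-lin zero    = id-linear
  fold-linear F-lin (suc n) = ∘-linear F-lin (fold-linear F-lin n)

  fold-comm : ∀ {F G} → IsLinear F → IsLinear G → (∀ s → G (F s) ≋ F (G s)) →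
              ∀ s n → G (fold s F n) ≋ fold (G s) F n
  fold-comm F-lin G-lin GF≋FG s zero    = ≋-refl
  fold-comm F-lin G-lin GF≋FG s (suc n) =
    ≋-trans (GF≋FG _) (IsLinear.cong F-lin (fold-comm F-lin G-lin GF≋FG s n))

  fold-∘ : ∀ {F G} → IsLinear F → IsLinear G → (∀ s → G (F s) ≋ F (G s)) →
           ∀ s n → fold s (F ∘ G) n ≋ fold (fold s G n) F n
  fold-∘ F-lin G-lin GF≋FG s zero    = ≋-refl
  fold-∘ F-lin G-lin GF≋FG s (suc n) = IsLinear.cong F-lin
    (≋-trans (IsLinear.cong G-lin (fold-∘ F-lin G-lin GF≋FG s n)) (fold-comm F-lin G-lin GF≋FG _ n))

  /[1-t]-cong : ∀ {s s′ z z′} → s ≋ s′ → z ≈ z′ → s /[1- z t] ≋ s′ /[1- z′ t]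
  /[1-t]-cong s≋s′ z≈z′ zero    = s≋s′ zero
  /[1-t]-cong s≋s′ z≈z′ (suc j) =
    +-cong (s≋s′ (suc j)) (*-cong z≈z′ (/[1-t]-cong s≋s′ z≈z′ j))

  /[1-t]-linear : ∀ z → IsLinear (_/[1- z t])
  /[1-t]-linear z = record
    { cong    = λ s≋s′ → /[1-t]-cong s≋s′ refl
    ; ⊕-homo  = ⊕-homo
    ; ·-homo  = ·-homo
    ; t·-homo = t·-homo
    }
    where
    ⊕-homo : ∀ s s′ → (s ⊕ s′) /[1- z t] ≋ s /[1- z t] ⊕ s′ /[1- z t]
    ⊕-homo s s′ zero    = refl
    ⊕-homo s s′ (suc j) = trans (+-congˡ (*-congˡ (⊕-homo s s′ j)))
      (solve 5 (λ a b z u v → a :+ b :+ z :* (u :+ v) := a :+ z :* u :+ (b :+ z :* v))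
             refl (s (suc j)) (s′ (suc j)) z ((s /[1- z t]) j) ((s′ /[1- z t]) j))

    ·-homo : ∀ x s → (x · s) /[1- z t] ≋ x · s /[1- z t]
    ·-homo x s zero    = refl
    ·-homo x s (suc j) = trans (+-congˡ (*-congˡ (·-homo x s j)))
      (solve 4 (λ x a z u → x :* a :+ z :* (x :* u) := x :* (a :+ z :* u))
             refl x (s (suc j)) z ((s /[1- z t]) j))

    t·-homo : ∀ s → (t· s) /[1- z t] ≋ t· s /[1- z t]
    t·-homo s zero          = refl
    t·-homo s (suc zero)    = trans (+-congˡ (zeroʳ z)) (+-identityʳ _)
    t·-homo s (suc (suc j)) = +-congˡ (*-congˡ (t·-homo s (suc j)))

  /[1-t]-as-sum : ∀ s z j → (s /[1- z t]) j ≈ Σ≤ j (λ i → z ^ i * s (j ∸ i))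
  /[1-t]-as-sum s z zero    = sym (trans (+-identityˡ _) (*-identityˡ _))
  /[1-t]-as-sum s z (suc j) = begin
    s (suc j) + z * (s /[1- z t]) j
      ≈⟨ +-cong (*-identityˡ _) (*-congˡ (sym (/[1-t]-as-sum s z j))) ⟨
    1# * s (suc j) + z * Σ≤ j (λ i → z ^ i * s (j ∸ i))
      ≈⟨ +-congˡ (*-distribˡ-Σ< (suc j) z _) ⟩
    1# * s (suc j) + Σ≤ j (λ i → z * (z ^ i * s (j ∸ i)))
      ≈⟨ +-congˡ (Σ<-cong (suc j) (λ i _ → *-assoc _ _ _)) ⟨
    1# * s (suc j) + Σ≤ j (λ i → z ^ suc i * s (suc j ∸ suc i))
      ≈⟨ Σ<-suc (suc j) _ ⟨
    Σ≤ (suc j) (λ i → z ^ i * s (suc j ∸ i)) ∎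

  δ/[1-t] : ∀ z j → (δ /[1- z t]) j ≈ z ^ j
  δ/[1-t] z zero    = refl
  δ/[1-t] z (suc j) = trans (+-identityˡ _) (*-congˡ (δ/[1-t] z j))

  ⋆-/[1-t] : ∀ x z s → x ⋆ (s /[1- z t]) ≋ (x ⋆ s) /[1- x * z t]
  ⋆-/[1-t] x z s zero    = refl
  ⋆-/[1-t] x z s (suc j) = begin
    (x * x ^ j) * (s (suc j) + z * (s /[1- z t]) j)
      ≈⟨ solve 5 (λ x y a z u → (x :* y) :* (a :+ z :* u) := (x :* y) :* a :+ (x :* z) :* (y :* u))
               refl x (x ^ j) (s (suc j)) z ((s /[1- z t]) j) ⟩
    (x * x ^ j) * s (suc j) + (x * z) * (x ^ j * (s /[1- z t]) j)
      ≈⟨ +-congˡ (*-congˡ (⋆-/[1-t] x z s j)) ⟩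
    (x * x ^ j) * s (suc j) + (x * z) * ((x ⋆ s) /[1- x * z t]) j ∎

  -- Recurrence σ π v u is the identity (1 - σ t + π t²) u = v, written without subtraction.
  Recurrence : Carrier → Carrier → Seq → Seq → Set ℓ
  Recurrence σ π v u = u ⊕ π · t· t· u ≋ v ⊕ σ · t· u

  recurrence-cong : ∀ {σ σ′ π π′ v u} → σ ≈ σ′ → π ≈ π′ →
                    Recurrence σ π v u → Recurrence σ′ π′ v u
  recurrence-cong σ≈σ′ π≈π′ rec j =
    trans (+-congˡ (*-congʳ (sym π≈π′))) (trans (rec j) (+-congˡ (*-congʳ σ≈σ′)))

  recurrence-unique : ∀ {σ π v u u′} → Recurrence σ π v u → Recurrence σ π v u′ → u ≋ u′
  recurrence-unique {σ} {π} {v} {u} {u′} rec rec′ j = determined j (earlier j)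
    where
    determined : ∀ j → (t· u) j ≈ (t· u′) j × (t· t· u) j ≈ (t· t· u′) j → u j ≈ u′ j
    determined j (tu≈tu′ , ttu≈ttu′) = ∙-cancelʳ (π * (t· t· u) j) (u j) (u′ j) (begin
      u j  + π * (t· t· u) j   ≈⟨ rec j ⟩
      v j  + σ * (t· u) j      ≈⟨ +-congˡ (*-congˡ tu≈tu′) ⟩
      v j  + σ * (t· u′) j     ≈⟨ rec′ j ⟨
      u′ j + π * (t· t· u′) j  ≈⟨ +-congˡ (*-congˡ ttu≈ttu′) ⟨
      u′ j + π * (t· t· u) j   ∎)

    earlier : ∀ j → (t· u) j ≈ (t· u′) j × (t· t· u) j ≈ (t· t· u′) j
    earlier zero    = refl , refl
    earlier (suc j) = determined j (earlier j) , proj₁ (earlier j)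

  /[1-t]²-recurrence : ∀ x y v → Recurrence (x + y) (x * y) v (v /[1- y t] /[1- x t])
  /[1-t]²-recurrence x y v zero          =
    solve 3 (λ v x y → v :+ x :* y :* con 0 := v :+ (x :+ y) :* con 0) refl (v 0) x y
  /[1-t]²-recurrence x y v (suc zero)    =
    solve 4 (λ v₁ v₀ x y → v₁ :+ y :* v₀ :+ x :* v₀ :+ x :* y :* con 0 := v₁ :+ (x :+ y) :* v₀)
          refl (v 1) (v 0) x y
  /[1-t]²-recurrence x y v (suc (suc j)) =
    solve 5 (λ v₂ p₁ w₀ x y → v₂ :+ y :* p₁ :+ x :* (p₁ :+ x :* w₀) :+ x :* y :* w₀
                           := v₂ :+ (x :+ y) :* (p₁ :+ x :* w₀))
          refl (v (suc (suc j))) ((v /[1- y t]) (suc j)) ((v /[1- y t] /[1- x t]) j) x y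

  /[1-t]-comm : ∀ x y v → v /[1- y t] /[1- x t] ≋ v /[1- x t] /[1- y t]
  /[1-t]-comm x y v = recurrence-unique (/[1-t]²-recurrence x y v)
    (recurrence-cong (+-comm y x) (*-comm y x) (/[1-t]²-recurrence y x v))

  -- a + b = x + y and a b + c = x y say that (1 - a t)(1 - b t) = (1 - x t)(1 - y t) - c t².
  pair-fixpoint : ∀ {a b x y c} → a + b ≈ x + y → a * b + c ≈ x * y →
                  let H = δ /[1- b t] /[1- a t] in H ≋ (δ ⊕ c · t· t· H) /[1- y t] /[1- x t]
  pair-fixpoint {a} {b} {x} {y} {c} a+b≈x+y ab+c≈xy =
    recurrence-unique rec (/[1-t]²-recurrence x y (δ ⊕ c · t· t· H))
    where
    H = δ /[1- b t] /[1- a t]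
    rec : Recurrence (x + y) (x * y) (δ ⊕ c · t· t· H) H
    rec j = begin
      H j + x * y * (t· t· H) j
        ≈⟨ +-congˡ (*-congʳ ab+c≈xy) ⟨
      H j + (a * b + c) * (t· t· H) j
        ≈⟨ solve 5 (λ h a b c u → h :+ (a :* b :+ c) :* u := h :+ a :* b :* u :+ c :* u)
                 refl (H j) a b c ((t· t· H) j) ⟩
      H j + a * b * (t· t· H) j + c * (t· t· H) j
        ≈⟨ +-congʳ (/[1-t]²-recurrence a b δ j) ⟩
      δ j + (a + b) * (t· H) j + c * (t· t· H) j
        ≈⟨ +-congʳ (+-congˡ (*-congʳ a+b≈x+y)) ⟩
      δ j + (x + y) * (t· H) j + c * (t· t· H) j
        ≈⟨ solve 4 (λ d σ u w → d :+ σ :* u :+ w := d :+ w :+ σ :* u)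
                 refl (δ j) (x + y) ((t· H) j) (c * (t· t· H) j) ⟩
      δ j + c * (t· t· H) j + (x + y) * (t· H) j ∎

  ∸-2*suc : ∀ m k → suc (suc m) ∸ 2 N.* suc k ≡ m ∸ 2 N.* k
  ∸-2*suc m k = ≡.cong (suc m ∸_) (NP.+-suc k (k N.+ 0))

  module _ {G} (G-linear : IsLinear G) {c H} (H≋ : H ≋ G (δ ⊕ c · t· t· H)) where

    fixpoint-unfold : ∀ {F} → IsLinear F → F H ≋ F (G δ) ⊕ c · t· t· F (G H)
    fixpoint-unfold {F} F-lin j = begin
      F H j                                ≈⟨ IsLinear.cong F-lin H≋ j ⟩
      F (G (δ ⊕ c · t· t· H)) j            ≈⟨ FG.⊕-homo _ _ j ⟩
      (F (G δ) ⊕ F (G (c · t· t· H))) j    ≈⟨ +-congˡ (FG.·-homo c _ j) ⟩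
      (F (G δ) ⊕ c · F (G (t· t· H))) j    ≈⟨ +-congˡ (*-congˡ (FG.t·-homo _ j)) ⟩
      (F (G δ) ⊕ c · t· F (G (t· H))) j    ≈⟨ +-congˡ (*-congˡ (t·-cong (FG.t·-homo _) j)) ⟩
      (F (G δ) ⊕ c · t· t· F (G H)) j      ∎
      where module FG = IsLinear (∘-linear F-lin G-linear)

    -- Stated for every linear F so that the induction can pass from F to F ∘ G.
    fixpoint-expansion : ∀ {F} → IsLinear F → ∀ m →
      F H m ≈ Σ≤ ⌊ m /2⌋ (λ k → c ^ k * F (fold δ G (suc k)) (m ∸ 2 N.* k))
    fixpoint-expansion F-lin zero          = trans (fixpoint-unfold F-lin 0)
      (solve 2 (λ u c → u :+ c :* con 0 := con 0 :+ con 1 :* u) refl _ c)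
    fixpoint-expansion F-lin (suc zero)    = trans (fixpoint-unfold F-lin 1)
      (solve 2 (λ u c → u :+ c :* con 0 := con 0 :+ con 1 :* u) refl _ c)
    fixpoint-expansion {F} F-lin (suc (suc m)) = begin
      F H (2 N.+ m)
        ≈⟨ fixpoint-unfold F-lin (2 N.+ m) ⟩
      F (G δ) (2 N.+ m) + c * F (G H) m
        ≈⟨ +-cong (*-identityˡ _) (*-congˡ (sym (fixpoint-expansion (∘-linear F-lin G-linear) m))) ⟨
      1# * F (G δ) (2 N.+ m) + c * Σ≤ ⌊ m /2⌋ (λ k → c ^ k * F (fold δ G (2 N.+ k)) (m ∸ 2 N.* k))
        ≈⟨ +-congˡ (*-distribˡ-Σ< (suc ⌊ m /2⌋) c _) ⟩
      1# * F (G δ) (2 N.+ m) + Σ≤ ⌊ m /2⌋ (λ k → c * (c ^ k * F (fold δ G (2 N.+ k)) (m ∸ 2 N.* k)))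
        ≈⟨ +-congˡ (Σ<-cong (suc ⌊ m /2⌋) (λ k _ → trans (*-assoc _ _ _)
             (*-congˡ (*-congˡ (reflexive (≡.cong (F (fold δ G (2 N.+ k))) (∸-2*suc m k))))))) ⟨
      1# * F (G δ) (2 N.+ m)
        + Σ≤ ⌊ m /2⌋ (λ k → c ^ suc k * F (fold δ G (2 N.+ k)) (2 N.+ m ∸ 2 N.* suc k))
        ≈⟨ Σ<-suc (suc ⌊ m /2⌋) _ ⟨
      Σ≤ ⌊ 2 N.+ m /2⌋ (λ k → c ^ k * F (fold δ G (suc k)) (2 N.+ m ∸ 2 N.* k)) ∎

  h[_] : List Carrier → Seq
  h[ L ] j = h j L

  h[]≋δ : h[ [] ] ≋ δ
  h[]≋δ zero    = refl
  h[]≋δ (suc j) = refl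

  h[∷] : ∀ z L → h[ z ∷ L ] ≋ h[ L ] /[1- z t]
  h[∷] z L zero    = refl
  h[∷] z L (suc j) = sym (/[1-t]-as-sum h[ L ] z (suc j))

  h[replicate++] : ∀ z n L → h[ replicate n z ++ L ] ≋ h[ L ] /[1- z t]^ n
  h[replicate++] z zero    L = ≋-refl
  h[replicate++] z (suc n) L = ≋-trans (h[∷] z _) (/[1-t]-cong (h[replicate++] z n L) refl)

  h[replicate] : ∀ z n → h[ replicate n z ] ≋ δ /[1- z t]^ n
  h[replicate] z n j = begin
    h j (replicate n z)               ≡⟨ ≡.cong (h j) (++-identityʳ (replicate n z)) ⟨
    h j (replicate n z ++ [])         ≈⟨ h[replicate++] z n [] j ⟩
    (h[ [] ] /[1- z t]^ n) j          ≈⟨ IsLinear.cong (fold-linear (/[1-t]-linear z) n) h[]≋δ j ⟩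
    (δ /[1- z t]^ n) j                ∎

  h-homogeneous : ∀ x {L′ L} → Pointwise (λ u v → u ≈ x * v) L′ L → h[ L′ ] ≋ x ⋆ h[ L ]
  h-homogeneous x []                      zero    = sym (*-identityˡ _)
  h-homogeneous x []                      (suc j) = sym (zeroʳ _)
  h-homogeneous x {u ∷ L′} {v ∷ L} (u≈xv ∷ L′≈xL) j = begin
    h j (u ∷ L′)                      ≈⟨ h[∷] u L′ j ⟩
    (h[ L′ ] /[1- u t]) j             ≈⟨ /[1-t]-cong (h-homogeneous x L′≈xL) u≈xv j ⟩
    ((x ⋆ h[ L ]) /[1- x * v t]) j    ≈⟨ ⋆-/[1-t] x v h[ L ] j ⟨
    (x ⋆ h[ L ] /[1- v t]) j          ≈⟨ ⋆-congˡ x (h[∷] v L) j ⟨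
    (x ⋆ h[ v ∷ L ]) j                ∎

  h[pair] : ∀ a b → h[ a ∷ b ∷ [] ] ≋ δ /[1- b t] /[1- a t]
  h[pair] a b = ≋-trans (h[∷] a _) (/[1-t]-cong (≋-trans (h[∷] b []) (/[1-t]-cong h[]≋δ refl)) refl)

  h-pair-expansion : ∀ {a b x y c} → a + b ≈ x + y → a * b + c ≈ x * y → ∀ m →
    h m (a ∷ b ∷ [])
      ≈ Σ≤ ⌊ m /2⌋ (λ k → c ^ k * h (m ∸ 2 N.* k) (replicate (suc k) x ++ replicate (suc k) y))
  h-pair-expansion {a} {b} {x} {y} {c} a+b≈x+y ab+c≈xy m = begin
    h m (a ∷ b ∷ [])
      ≈⟨ h[pair] a b m ⟩
    (δ /[1- b t] /[1- a t]) m
      ≈⟨ fixpoint-expansion G-linear (pair-fixpoint a+b≈x+y ab+c≈xy) id-linear m ⟩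
    Σ≤ ⌊ m /2⌋ (λ k → c ^ k * fold δ G (suc k) (m ∸ 2 N.* k))
      ≈⟨ Σ<-cong (suc ⌊ m /2⌋) (λ k _ → *-congˡ (G-power (suc k) (m ∸ 2 N.* k))) ⟩
    Σ≤ ⌊ m /2⌋ (λ k → c ^ k * h (m ∸ 2 N.* k) (replicate (suc k) x ++ replicate (suc k) y)) ∎
    where
    G : Seq → Seq
    G s = s /[1- y t] /[1- x t]

    G-linear : IsLinear G
    G-linear = ∘-linear (/[1-t]-linear x) (/[1-t]-linear y)

    G-power : ∀ n → fold δ G n ≋ h[ replicate n x ++ replicate n y ]
    G-power n = ≋-trans
      (fold-∘ (/[1-t]-linear x) (/[1-t]-linear y) (/[1-t]-comm y x) δ n)
      (≋-sym (≋-trans (h[replicate++] x n _)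
                      (IsLinear.cong (fold-linear (/[1-t]-linear x) n) (h[replicate] y n))))

  h-pair-suc : ∀ a b m → h (suc m) (a ∷ b ∷ []) ≈ b ^ suc m + a * h m (a ∷ b ∷ [])
  h-pair-suc a b m = trans (h[pair] a b (suc m)) (+-cong (δ/[1-t] b (suc m)) (*-congˡ (sym (h[pair] a b m))))

  ^suc-difference : ∀ {a b d} → a ≈ b + d → ∀ m → a ^ suc m - b ^ suc m ≈ d * h m (a ∷ b ∷ [])
  ^suc-difference {a} {b} {d} a≈b+d m =
    sym (x≈z//y _ _ _ (trans (+-comm _ _) (sym (telescope m))))
    where
    telescope : ∀ m → a ^ suc m ≈ b ^ suc m + d * h m (a ∷ b ∷ [])
    telescope zero    = trans (*-congʳ a≈b+d) (distribʳ 1# b d)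
    telescope (suc m) = begin
      a * a ^ suc m
        ≈⟨ *-congˡ (telescope m) ⟩
      a * (bᵐ + d * hₘ)
        ≈⟨ solve 4 (λ a bᵐ d hₘ → a :* (bᵐ :+ d :* hₘ) := a :* bᵐ :+ d :* (a :* hₘ))
                 refl a bᵐ d hₘ ⟩
      a * bᵐ + d * (a * hₘ)
        ≈⟨ +-congʳ (*-congʳ a≈b+d) ⟩
      (b + d) * bᵐ + d * (a * hₘ)
        ≈⟨ solve 4 (λ b d bᵐ ahₘ → (b :+ d) :* bᵐ :+ d :* ahₘ := b :* bᵐ :+ d :* (bᵐ :+ ahₘ))
                 refl b d bᵐ (a * hₘ) ⟩
      b * bᵐ + d * (bᵐ + a * hₘ)
        ≈⟨ +-congˡ (*-congˡ (h-pair-suc a b m)) ⟨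
      b * bᵐ + d * h (suc m) (a ∷ b ∷ []) ∎
      where
      bᵐ = b ^ suc m
      hₘ = h m (a ∷ b ∷ [])

  qint-suc : ∀ q k → q * qint q k + 1# ≈ qint q (suc k)
  qint-suc q zero    = +-congʳ (zeroʳ q)
  qint-suc q (suc k) = begin
    q * (qint q k + q ^ k) + 1#
      ≈⟨ solve 3 (λ q s p → q :* (s :+ p) :+ con 1 := q :* s :+ con 1 :+ q :* p)
               refl q (qint q k) (q ^ k) ⟩
    q * qint q k + 1# + q * q ^ k
      ≈⟨ +-congʳ (qint-suc q k) ⟩
    qint q (suc k) + q ^ suc k ∎

  qint2*qint2l/qint2 : ∀ q l → qint q 2 * qint2l/qint2 q l ≈ qint q l * (1# + q ^ l)
  qint2*qint2l/qint2 q zero    = trans (zeroʳ _) (sym (zeroˡ _))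
  qint2*qint2l/qint2 q (suc l) = begin
    qint q 2 * (qint2l/qint2 q l + q ^ (2 N.* l))
      ≈⟨ trans (distribˡ _ _ _) (+-cong (qint2*qint2l/qint2 q l) (*-congˡ (^-double q l))) ⟩
    x * (1# + Q) + qint q 2 * (Q * Q)
      ≈⟨ solve 3 (λ x Q q → x :* (con 1 :+ Q) :+ ((con 0 :+ con 1) :+ q :* con 1) :* (Q :* Q)
                          := x :+ Q :* (x :+ Q) :+ q :* (Q :* Q)) refl x Q q ⟩
    x + Q * (x + Q) + q * (Q * Q)
      ≈⟨ +-congʳ (+-congˡ (*-congˡ (qint-suc q l))) ⟨
    x + Q * (q * x + 1#) + q * (Q * Q)
      ≈⟨ solve 3 (λ x Q q → x :+ Q :* (q :* x :+ con 1) :+ q :* (Q :* Q)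
                          := (x :+ Q) :* (con 1 :+ q :* Q)) refl x Q q ⟩
    (x + Q) * (1# + q * Q) ∎
    where
    x = qint q l
    Q = q ^ l

  k≤⌊m/2⌋⇒∃[j]m≡k+[k+j] : ∀ {m k} → k ≤ ⌊ m /2⌋ → ∃ λ j → m ≡ k N.+ (k N.+ j)
  k≤⌊m/2⌋⇒∃[j]m≡k+[k+j] {m}           {zero}  _         = m , ≡.refl
  k≤⌊m/2⌋⇒∃[j]m≡k+[k+j] {suc (suc m)} {suc k} (s≤s k≤) =
    let j , m≡ = k≤⌊m/2⌋⇒∃[j]m≡k+[k+j] k≤
    in  j , ≡.cong suc (≡.trans (≡.cong suc m≡) (≡.sym (NP.+-suc k (k N.+ j))))

  summand-match : ∀ {q q⁻¹} → q * q⁻¹ ≈ 1# → ∀ l e m k → k ≤ ⌊ m /2⌋ →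
    let x = qint q l; C = q ^ l; P = x * q⁻¹ ^ l in
    P * (1# + C) * (P ^ m * (C ^ k * (x ^ (m ∸ 2 N.* k) * e)))
      ≈ qint q 2 * (e * qint2l/qint2 q l * x ^ (2 N.* (m ∸ k)) * q⁻¹ ^ (l N.* suc (m ∸ k)))
  summand-match {q} {q⁻¹} qq⁻¹≈1 l e m k k≤ with k≤⌊m/2⌋⇒∃[j]m≡k+[k+j] {m} {k} k≤
  ... | j , ≡.refl = begin
    P * (1# + C) * (P ^ m * (C ^ k * (x ^ (m ∸ 2 N.* k) * e)))
      ≈⟨ solve 6 (λ P D Pᵐ Cᵏ X e → P :* D :* (Pᵐ :* (Cᵏ :* (X :* e)))
                                   := D :* e :* (P :* Pᵐ :* (Cᵏ :* X)))
               refl P (1# + C) (P ^ m) (C ^ k) (x ^ (m ∸ 2 N.* k)) e ⟩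
    (1# + C) * e * (P ^ suc m * (C ^ k * x ^ (m ∸ 2 N.* k)))
      ≡⟨ ≡.cong (λ i → (1# + C) * e * (P ^ suc m * (C ^ k * x ^ i))) m∸2k≡j ⟩
    (1# + C) * e * (P ^ suc m * (C ^ k * x ^ j))
      ≈⟨ *-congˡ (power-split (^-inverse qq⁻¹≈1 l) k j) ⟩
    (1# + C) * e * (x * x ^ (2 N.* (k N.+ j)) * (q⁻¹ ^ l) ^ suc (k N.+ j))
      ≈⟨ *-congˡ (*-congˡ (^-assocʳ q⁻¹ l (suc (k N.+ j)))) ⟨
    (1# + C) * e * (x * x ^ (2 N.* (k N.+ j)) * q⁻¹ ^ (l N.* suc (k N.+ j)))
      ≡⟨ ≡.cong (λ u → (1# + C) * e * (x * x ^ (2 N.* u) * q⁻¹ ^ (l N.* suc u))) m∸k≡k+j ⟨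
    (1# + C) * e * (x * X * Y)
      ≈⟨ solve 5 (λ D e x X Y → D :* e :* (x :* X :* Y) := x :* D :* (e :* X :* Y))
               refl (1# + C) e x X Y ⟩
    x * (1# + C) * (e * X * Y)
      ≈⟨ *-congʳ (qint2*qint2l/qint2 q l) ⟨
    qint q 2 * S * (e * X * Y)
      ≈⟨ solve 5 (λ T S e X Y → T :* S :* (e :* X :* Y) := T :* (e :* S :* X :* Y))
               refl (qint q 2) S e X Y ⟩
    qint q 2 * (e * S * X * Y) ∎
    where
    x = qint q l
    C = q ^ l
    P = x * q⁻¹ ^ l
    S = qint2l/qint2 q l
    X = x ^ (2 N.* (m ∸ k))
    Y = q⁻¹ ^ (l N.* suc (m ∸ k))
    m∸k≡k+j : m ∸ k ≡ k N.+ j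
    m∸k≡k+j = NP.m+n∸m≡n k (k N.+ j)
    m∸2k≡j : m ∸ 2 N.* k ≡ j
    m∸2k≡j = ≡.trans (NP.[m+n]∸[m+o]≡n∸o k (k N.+ j) (k N.+ 0)) (NP.[m+n]∸[m+o]≡n∸o k j 0)

  -- The notation of the header for l = suc n; a is x + C by the definition of qint.
  module Consecutive {q q⁻¹ : Carrier} (qq⁻¹≈1 : q * q⁻¹ ≈ 1#) (n : ℕ) where
    x b C a P A B : Carrier
    x = qint q (suc n)
    b = q * qint q n
    C = q ^ suc n
    a = qint q (suc (suc n))
    P = x * q⁻¹ ^ suc n
    A = x * a * q⁻¹ ^ suc n
    B = qint q n * x * q⁻¹ ^ n

    x≈b+1 : x ≈ b + 1#
    x≈b+1 = sym (qint-suc q n)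

    xq≈b+C : x * q ≈ b + C
    xq≈b+C = ∙-cancelʳ 1# _ _ (begin
      x * q + 1#     ≈⟨ +-congʳ (*-comm x q) ⟩
      q * x + 1#     ≈⟨ qint-suc q (suc n) ⟩
      x + C          ≈⟨ +-congʳ x≈b+1 ⟩
      b + 1# + C     ≈⟨ solve 2 (λ b C → b :+ con 1 :+ C := b :+ C :+ con 1) refl b C ⟩
      b + C + 1#     ∎)

    a+b≈x+xq : a + b ≈ x + x * q
    a+b≈x+xq = begin
      x + C + b      ≈⟨ solve 3 (λ x C b → x :+ C :+ b := x :+ (b :+ C)) refl x C b ⟩
      x + (b + C)    ≈⟨ +-congˡ xq≈b+C ⟨
      x + x * q      ∎

    ab+C≈x·xq : a * b + C ≈ x * (x * q)
    ab+C≈x·xq = begin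
      (x + C) * b + C
        ≈⟨ +-congʳ (*-congʳ (+-congʳ x≈b+1)) ⟩
      (b + 1# + C) * b + C
        ≈⟨ solve 2 (λ b C → (b :+ con 1 :+ C) :* b :+ C := (b :+ con 1) :* (b :+ C)) refl b C ⟩
      (b + 1#) * (b + C)
        ≈⟨ *-cong x≈b+1 xq≈b+C ⟨
      x * (x * q) ∎

    A≈Pa : A ≈ P * a
    A≈Pa = solve 3 (λ x a Q → x :* a :* Q := x :* Q :* a) refl x a (q⁻¹ ^ suc n)

    B≈Pb : B ≈ P * b
    B≈Pb = begin
      s * x * Qⁿ
        ≈⟨ *-identityʳ _ ⟨
      s * x * Qⁿ * 1#
        ≈⟨ *-congˡ qq⁻¹≈1 ⟨
      s * x * Qⁿ * (q * q⁻¹)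
        ≈⟨ solve 5 (λ s x Qⁿ q q⁻¹ → s :* x :* Qⁿ :* (q :* q⁻¹) := x :* (q⁻¹ :* Qⁿ) :* (q :* s))
                 refl s x Qⁿ q q⁻¹ ⟩
      P * b ∎
      where
      s = qint q n
      Qⁿ = q⁻¹ ^ n

    A≈B+P[1+C] : A ≈ B + P * (1# + C)
    A≈B+P[1+C] = begin
      A
        ≈⟨ A≈Pa ⟩
      P * (x + C)
        ≈⟨ *-congˡ (+-congʳ x≈b+1) ⟩
      P * (b + 1# + C)
        ≈⟨ solve 3 (λ P b C → P :* (b :+ con 1 :+ C) := P :* b :+ P :* (con 1 :+ C)) refl P b C ⟩
      P * b + P * (1# + C)
        ≈⟨ +-congʳ B≈Pb ⟨
      B + P * (1# + C) ∎

    xxq : ℕ → List Carrier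
    xxq r = replicate r x ++ replicate r (x * q)

    xxq≈x·ones-qs : ∀ r → Pointwise (λ u v → u ≈ x * v) (xxq r) (ones-qs q r)
    xxq≈x·ones-qs r = ++⁺ (replicate⁺ (sym (*-identityʳ x)) r) (replicate⁺ refl r)

lemma3 : ∀ {c ℓ} (R : CommutativeRing c ℓ) →
    let open CommutativeRing R in
    let open QOps R in
    (q q⁻¹ : Carrier) → q * q⁻¹ ≈ 1# →
    (m l : ℕ) → l ≥ 1 →
      ((qint q l * qint q (suc l)) * q⁻¹ ^ l) ^ suc m
        - ((qint q (l ∸ 1) * qint q l) * q⁻¹ ^ (l ∸ 1)) ^ suc m
      ≈ qint q 2 * Σ≤ ⌊ m /2⌋ (λ k →
          h (m ∸ 2 N.* k) (ones-qs q (suc k))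
            * qint2l/qint2 q l
            * qint q l ^ (2 N.* (m ∸ k))
            * q⁻¹ ^ (l N.* (suc (m ∸ k))))
lemma3 R q q⁻¹ qq⁻¹≈1 m (suc n) _ = begin
  A ^ suc m - B ^ suc m
    ≈⟨ ^suc-difference A≈B+P[1+C] m ⟩
  P * (1# + C) * h m (A ∷ B ∷ [])
    ≈⟨ *-congˡ (h-homogeneous P (A≈Pa ∷ B≈Pb ∷ []) m) ⟩
  P * (1# + C) * (P ^ m * h m (a ∷ b ∷ []))
    ≈⟨ *-congˡ (*-congˡ (h-pair-expansion a+b≈x+xq ab+C≈x·xq m)) ⟩
  P * (1# + C) * (P ^ m * Σ≤ ⌊ m /2⌋ (λ k → C ^ k * h (m ∸ 2 N.* k) (xxq (suc k))))
    ≈⟨ trans (*-congˡ (*-distribˡ-Σ< (suc ⌊ m /2⌋) _ _)) (*-distribˡ-Σ< (suc ⌊ m /2⌋) _ _) ⟩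
  Σ≤ ⌊ m /2⌋ (λ k → P * (1# + C) * (P ^ m * (C ^ k * h (m ∸ 2 N.* k) (xxq (suc k)))))
    ≈⟨ Σ<-cong (suc ⌊ m /2⌋) (λ k k< → trans
         (*-congˡ (*-congˡ (*-congˡ (h-homogeneous x (xxq≈x·ones-qs (suc k)) (m ∸ 2 N.* k)))))
         (summand-match qq⁻¹≈1 (suc n) _ m k (NP.≤-pred k<))) ⟩
  Σ≤ ⌊ m /2⌋ (λ k → qint q 2 * (h (m ∸ 2 N.* k) (ones-qs q (suc k)) * qint2l/qint2 q (suc n)
                                  * x ^ (2 N.* (m ∸ k)) * q⁻¹ ^ (suc n N.* suc (m ∸ k))))
    ≈⟨ *-distribˡ-Σ< (suc ⌊ m /2⌋) _ _ ⟨
  _ ∎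
  where
  open CommutativeRing R hiding (zero)
  open QOps R
  open GeneratingFunctions R
  open Consecutive qq⁻¹≈1 n
  open SetoidReasoning setoid
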